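{- Let $\mathfrak{w}$ be a nonempty binary word and $k,h\in\mathbb{N}$ with $k+h\geq 1$, and let $\psi$ be the morphism $\psi(0)=\Theta(\mathfrak{w}(\mathrm{R}(\mathfrak{w})\mathfrak{w})^k)$, $\psi(1)=\Theta((\mathrm{R}(\mathfrak{w})\mathfrak{w})^h\mathrm{R}(\mathfrak{w}))$. Let $\xi:\{0,1\}^*\to\{0,1\}^*$ be given by $\xi(0)=\Theta(\mathfrak{w})$ and $\xi(1)=\Theta\big((\mathrm{R}(\mathfrak{w})\mathfrak{w})^{k+h}\mathrm{R}(\mathfrak{w})\big)$. Then an infinite word $\mathbf{u}$ is a fixed point of $\psi$ if and only if it is a fixed point of $\xi$.
   Context: $\mathbb{N}=\{0,1,2,\dots\}$. $\mathrm{R}(w_1\cdots w_n)=w_n\cdots w_1$. $\Theta$ is the Thue–Morse morphism $\Theta(0)=01$, $\Theta(1)=10$. Morphisms are extended letterwise to infinite words; $\mathbf{u}$ is a fixed point of $\psi$ if $\psi(\mathbf{u})=\mathbf{u}$. -}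

module Defs where

open import Data.Bool using (Bool; true; false)
open import Data.Nat using (ℕ; zero; suc; _+_)
open import Relation.Binary.PropositionalEquality using (_≡_)
open import Data.List using (List; []; _∷_; _++_; reverse; concat; concatMap; replicate)

-- Binary alphabet {0,1} encoded as Bool: false = 0, true = 1.
Word : Set
Word = List Bool

InfWord : Set
InfWord = ℕ → Bool

Morphism : Set
Morphism = Bool → Word

morph* : Morphism → Word → Word
morph* φ = concatMap φ

Θ₀ : Morphism
Θ₀ false = false ∷ true ∷ []
Θ₀ true  = true ∷ false ∷ []

Θ : Word → Word
Θ = morph* Θ₀

R : Word → Word
R = reverse

_^ʷ_ : Word → ℕ → Word
v ^ʷ k = concat (replicate k v)

prefix : ℕ → InfWord → Word
prefix zero    u = []
prefix (suc n) u = u 0 ∷ prefix n (λ i → u (suc i))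

-- n-th letter of a finite word (default false when out of range).
nth : Word → ℕ → Bool
nth []       _       = false
nth (x ∷ xs) zero    = x
nth (x ∷ xs) (suc n) = nth xs n

-- Letterwise extension of a morphism to infinite words:
-- φ(u)[n] is the n-th letter of φ(u[0..n+1)).  For morphisms whose letter
-- images are nonempty (the case in the statement), φ(u[0..n+1)) has length
-- ≥ n+1, so the default of nth is never used and this is exactly φ(u).
morphω : Morphism → InfWord → InfWord
morphω φ u n = nth (morph* φ (prefix (suc n) u)) n

IsFixedPoint : Morphism → InfWord → Set
IsFixedPoint φ u = ∀ n → morphω φ u n ≡ u n

ψ : Word → ℕ → ℕ → Morphism
ψ w k h false = Θ (w ++ ((R w ++ w) ^ʷ k))
ψ w k h true  = Θ (((R w ++ w) ^ʷ h) ++ R w)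

ξ : Word → ℕ → ℕ → Morphism
ξ w k h false = Θ w
ξ w k h true  = Θ (((R w ++ w) ^ʷ (k + h)) ++ R w)

module Submission where

-- Both ψ and ξ have the form c ↦ Θ(V c) with every V c nonempty.
--  (1) A fixed point u of such a morphism φ is a concatenation of the blocks
--      01 and 10, i.e. u(2i+1) = not u(2i) for all i ("u is Θ-blocked"), since
--      u = φ(u) = Θ(V(u)); equivalently every even-length prefix of u is the
--      Θ-image of the word of even-indexed letters of u.
--  (2) Two non-erasing morphisms that agree on all Θ-images produce the same
--      infinite word from any Θ-blocked u, because the letterwise image of u
--      can be read off long enough prefixes.  With (1), fixed points transfer
--      from one such morphism to the other.
--  (3) ψ and ξ agree on the two Θ-blocks: ψ(01) = ξ(01) and ψ(10) = ξ(10),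
--      because wP^k · P^h R(w) = w · P^(k+h) R(w) and
--      P^h R(w) · wP^k = P^(k+h) R(w) · w with P = R(w)w.  Hence ψ∘Θ = ξ∘Θ.
-- The theorem is (2) applied in both directions.

open import Defs
open import Data.Bool using (true; false; not)
open import Data.Nat using (ℕ; zero; suc; _+_; _∸_; _≤_; _<_; s≤s; z≤n)
open import Data.Nat.Properties
  using (+-suc; +-comm; +-mono-≤; ≤-trans; ≤-refl; ≤-reflexive; m≤m+n; m+[n∸m]≡n; n≤1+n)
open import Data.List using ([]; _∷_; _++_; length)
open import Data.List.Properties using (length-++; length-reverse; ++-assoc; ++-identityʳ)
open import Data.Empty using (⊥-elim)
open import Function.Bundles using (_⇔_; mk⇔)
open import Relation.Binary.PropositionalEquality
  using (_≡_; _≢_; refl; sym; trans; cong; cong₂; subst; module ≡-Reasoning)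
open ≡-Reasoning

NonErasing : Morphism → Set
NonErasing φ = ∀ c → 1 ≤ length (φ c)

morph-++ : ∀ (φ : Morphism) (xs ys : Word) → morph* φ (xs ++ ys) ≡ morph* φ xs ++ morph* φ ys
morph-++ φ []       ys = refl
morph-++ φ (x ∷ xs) ys = trans (cong (φ x ++_) (morph-++ φ xs ys)) (sym (++-assoc (φ x) _ _))

morph-length : ∀ (φ : Morphism) → NonErasing φ → ∀ xs → length xs ≤ length (morph* φ xs)
morph-length φ ne []       = z≤n
morph-length φ ne (x ∷ xs) =
  ≤-trans (+-mono-≤ (ne x) (morph-length φ ne xs)) (≤-reflexive (sym (length-++ (φ x))))

morph-compose : ∀ (φ χ V : Morphism) → (∀ c → φ c ≡ morph* χ (V c)) →
                ∀ xs → morph* φ xs ≡ morph* χ (morph* V xs)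
morph-compose φ χ V e []       = refl
morph-compose φ χ V e (x ∷ xs) =
  trans (cong₂ _++_ (e x) (morph-compose φ χ V e xs)) (sym (morph-++ χ (V x) _))

agree-on-images : ∀ (φ₁ φ₂ χ : Morphism) → (∀ c → morph* φ₁ (χ c) ≡ morph* φ₂ (χ c)) →
                  ∀ x → morph* φ₁ (morph* χ x) ≡ morph* φ₂ (morph* χ x)
agree-on-images φ₁ φ₂ χ ag []      = refl
agree-on-images φ₁ φ₂ χ ag (c ∷ x) = begin
  morph* φ₁ (χ c ++ morph* χ x)              ≡⟨ morph-++ φ₁ (χ c) _ ⟩
  morph* φ₁ (χ c) ++ morph* φ₁ (morph* χ x)  ≡⟨ cong₂ _++_ (ag c) (agree-on-images φ₁ φ₂ χ ag x) ⟩
  morph* φ₂ (χ c) ++ morph* φ₂ (morph* χ x)  ≡⟨ sym (morph-++ φ₂ (χ c) _) ⟩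
  morph* φ₂ (χ c ++ morph* χ x)              ∎

nth-++ : ∀ (xs ys : Word) n → n < length xs → nth (xs ++ ys) n ≡ nth xs n
nth-++ (x ∷ xs) ys zero    _       = refl
nth-++ (x ∷ xs) ys (suc n) (s≤s p) = nth-++ xs ys n p

prefix-length : ∀ n (u : InfWord) → length (prefix n u) ≡ n
prefix-length zero    u = refl
prefix-length (suc n) u = cong suc (prefix-length n (λ i → u (suc i)))

prefix-+ : ∀ a b (u : InfWord) → prefix (a + b) u ≡ prefix a u ++ prefix b (λ i → u (a + i))
prefix-+ zero    b u = refl
prefix-+ (suc a) b u = cong (u 0 ∷_) (prefix-+ a b (λ i → u (suc i)))

prefix-cong : ∀ n (u v : InfWord) → (∀ i → u i ≡ v i) → prefix n u ≡ prefix n v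
prefix-cong zero    u v e = refl
prefix-cong (suc n) u v e = cong₂ _∷_ (e 0) (prefix-cong n _ _ (λ i → e (suc i)))

morphω-from-prefix : ∀ (φ : Morphism) → NonErasing φ → ∀ u n M → n < M →
                     nth (morph* φ (prefix M u)) n ≡ morphω φ u n
morphω-from-prefix φ ne u n M n<M = begin
  nth (morph* φ (prefix M u)) n
    ≡⟨ cong (λ m → nth (morph* φ (prefix m u)) n) (sym (m+[n∸m]≡n n<M)) ⟩
  nth (morph* φ (prefix (suc n + (M ∸ suc n)) u)) n
    ≡⟨ cong (λ p → nth (morph* φ p) n) (prefix-+ (suc n) (M ∸ suc n) u) ⟩
  nth (morph* φ (head ++ tail)) n
    ≡⟨ cong (λ p → nth p n) (morph-++ φ head tail) ⟩
  nth (morph* φ head ++ morph* φ tail) n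
    ≡⟨ nth-++ (morph* φ head) (morph* φ tail) n n<image ⟩
  morphω φ u n ∎
  where
  head tail : Word
  head = prefix (suc n) u
  tail = prefix (M ∸ suc n) (λ i → u (suc n + i))
  n<image : n < length (morph* φ head)
  n<image = subst (_≤ length (morph* φ head)) (prefix-length (suc n) u) (morph-length φ ne head)

Θ-++ : ∀ (xs ys : Word) → Θ (xs ++ ys) ≡ Θ xs ++ Θ ys
Θ-++ = morph-++ Θ₀

Θ-nonempty : ∀ x → 1 ≤ length x → 1 ≤ length (Θ x)
Θ-nonempty (false ∷ _) _ = s≤s z≤n
Θ-nonempty (true  ∷ _) _ = s≤s z≤n

Θ∘-nonErasing : ∀ (φ V : Morphism) → (∀ c → φ c ≡ Θ (V c)) → NonErasing V → NonErasing φ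
Θ∘-nonErasing φ V e neV c = subst (λ y → 1 ≤ length y) (sym (e c)) (Θ-nonempty (V c) (neV c))

Θ-odd-letter : ∀ x i → i < length x → nth (Θ x) (suc (i + i)) ≡ not (nth (Θ x) (i + i))
Θ-odd-letter (false ∷ x) zero    _ = refl
Θ-odd-letter (true  ∷ x) zero    _ = refl
Θ-odd-letter (false ∷ x) (suc i) (s≤s p) rewrite +-suc i i = Θ-odd-letter x i p
Θ-odd-letter (true  ∷ x) (suc i) (s≤s p) rewrite +-suc i i = Θ-odd-letter x i p

-- u is a concatenation of the blocks 01 and 10, i.e. u = Θ(v) for some v.
ΘBlocked : InfWord → Set
ΘBlocked u = ∀ i → u (suc (i + i)) ≡ not (u (i + i))

evens : InfWord → InfWord
evens u i = u (i + i)

ΘBlocked-prefix : ∀ u → ΘBlocked u → ∀ j → prefix (j + j) u ≡ Θ (prefix j (evens u))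
ΘBlocked-prefix u blocked zero    = refl
ΘBlocked-prefix u blocked (suc j) rewrite +-suc j j = begin
  u 0 ∷ u 1 ∷ prefix (j + j) u''              ≡⟨ cong (λ b → u 0 ∷ b ∷ prefix (j + j) u'') (blocked 0) ⟩
  u 0 ∷ not (u 0) ∷ prefix (j + j) u''        ≡⟨ block (u 0) (ΘBlocked-prefix u'' blocked'' j) ⟩
  Θ₀ (u 0) ++ Θ (prefix j (evens u''))        ≡⟨ cong (λ p → Θ₀ (u 0) ++ Θ p) (prefix-cong j _ _ shift) ⟩
  Θ₀ (u 0) ++ Θ (prefix j (λ i → evens u (suc i))) ∎
  where
  u'' : InfWord
  u'' i = u (suc (suc i))
  blocked'' : ΘBlocked u''
  blocked'' i = subst (λ m → u (suc m) ≡ not (u m)) (+-suc (suc i) i) (blocked (suc i))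
  shift : ∀ i → evens u'' i ≡ evens u (suc i)
  shift i = cong (λ m → u (suc m)) (sym (+-suc i i))
  block : ∀ b {r s} → r ≡ s → b ∷ not b ∷ r ≡ Θ₀ b ++ s
  block false refl = refl
  block true  refl = refl

fixedPoint-ΘBlocked : ∀ (φ V : Morphism) → (∀ c → φ c ≡ Θ (V c)) → NonErasing V →
                      ∀ u → IsFixedPoint φ u → ΘBlocked u
fixedPoint-ΘBlocked φ V e neV u fix i =
  trans (letter (suc (i + i)) ≤-refl)
        (trans (Θ-odd-letter X i i<X) (cong not (sym (letter (i + i) (n≤1+n _)))))
  where
  M : ℕ
  M = suc (suc (i + i))
  X : Word
  X = morph* V (prefix M u)
  neφ : NonErasing φ
  neφ = Θ∘-nonErasing φ V e neV
  letter : ∀ j → j < M → u j ≡ nth (Θ X) j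
  letter j j<M = begin
    u j                                ≡⟨ sym (fix j) ⟩
    morphω φ u j                       ≡⟨ sym (morphω-from-prefix φ neφ u j M j<M) ⟩
    nth (morph* φ (prefix M u)) j      ≡⟨ cong (λ p → nth p j) (morph-compose φ Θ₀ V e (prefix M u)) ⟩
    nth (Θ X) j                        ∎
  i<X : i < length X
  i<X = ≤-trans (s≤s (m≤m+n i i))
          (≤-trans (n≤1+n _) (subst (_≤ length X) (prefix-length M u) (morph-length V neV (prefix M u))))

morphω-agree : ∀ (φ₁ φ₂ : Morphism) → NonErasing φ₁ → NonErasing φ₂ →
               (∀ x → morph* φ₁ (Θ x) ≡ morph* φ₂ (Θ x)) →
               ∀ u → ΘBlocked u → ∀ n → morphω φ₁ u n ≡ morphω φ₂ u n
morphω-agree φ₁ φ₂ ne₁ ne₂ ag u blocked n =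
  trans (sym (via φ₁ ne₁)) (trans (cong (λ p → nth p n) (ag evenPrefix)) (via φ₂ ne₂))
  where
  evenPrefix : Word
  evenPrefix = prefix (suc n) (evens u)
  via : ∀ (φ : Morphism) → NonErasing φ → nth (morph* φ (Θ evenPrefix)) n ≡ morphω φ u n
  via φ ne = trans (cong (λ p → nth (morph* φ p) n) (sym (ΘBlocked-prefix u blocked (suc n))))
                     (morphω-from-prefix φ ne u n (suc n + suc n) (m≤m+n (suc n) (suc n)))

fixedPoint-transfer : ∀ (φ₁ V₁ φ₂ V₂ : Morphism) → (∀ c → φ₁ c ≡ Θ (V₁ c)) → (∀ c → φ₂ c ≡ Θ (V₂ c)) →
                      NonErasing V₁ → NonErasing V₂ →
                      (∀ x → morph* φ₁ (Θ x) ≡ morph* φ₂ (Θ x)) →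
                      ∀ u → IsFixedPoint φ₁ u → IsFixedPoint φ₂ u
fixedPoint-transfer φ₁ V₁ φ₂ V₂ e₁ e₂ ne₁ ne₂ ag u fix n =
  trans (sym (morphω-agree φ₁ φ₂ (Θ∘-nonErasing φ₁ V₁ e₁ ne₁) (Θ∘-nonErasing φ₂ V₂ e₂ ne₂) ag u
                           (fixedPoint-ΘBlocked φ₁ V₁ e₁ ne₁ u fix) n))
        (fix n)

pow-+ : ∀ (P : Word) a b → P ^ʷ (a + b) ≡ (P ^ʷ a) ++ (P ^ʷ b)
pow-+ P zero    b = refl
pow-+ P (suc a) b = trans (cong (P ++_) (pow-+ P a b)) (sym (++-assoc P _ _))

pow-comm : ∀ (P : Word) a → P ++ (P ^ʷ a) ≡ (P ^ʷ a) ++ P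
pow-comm P zero    = ++-identityʳ P
pow-comm P (suc a) = trans (cong (P ++_) (pow-comm P a)) (sym (++-assoc P _ P))

nonempty : ∀ (v : Word) → v ≢ [] → 1 ≤ length v
nonempty []      v≢[] = ⊥-elim (v≢[] refl)
nonempty (_ ∷ _) _    = s≤s z≤n

nonempty-reverse : ∀ (v : Word) → v ≢ [] → 1 ≤ length (R v)
nonempty-reverse v v≢[] = subst (1 ≤_) (sym (length-reverse v)) (nonempty v v≢[])

nonempty-++ˡ : ∀ (v a : Word) → 1 ≤ length v → 1 ≤ length (v ++ a)
nonempty-++ˡ (_ ∷ _) a _ = s≤s z≤n

nonempty-++ʳ : ∀ (a v : Word) → 1 ≤ length v → 1 ≤ length (a ++ v)
nonempty-++ʳ []      v p = p
nonempty-++ʳ (_ ∷ _) v _ = s≤s z≤n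

Θ∘-pair-cong : ∀ (φ₁ V₁ φ₂ V₂ : Morphism) → (∀ c → φ₁ c ≡ Θ (V₁ c)) → (∀ c → φ₂ c ≡ Θ (V₂ c)) →
               ∀ a b → V₁ a ++ V₁ b ≡ V₂ a ++ V₂ b →
               morph* φ₁ (a ∷ b ∷ []) ≡ morph* φ₂ (a ∷ b ∷ [])
Θ∘-pair-cong φ₁ V₁ φ₂ V₂ e₁ e₂ a b eq = begin
  φ₁ a ++ (φ₁ b ++ [])          ≡⟨ cong (φ₁ a ++_) (++-identityʳ (φ₁ b)) ⟩
  φ₁ a ++ φ₁ b                  ≡⟨ cong₂ _++_ (e₁ a) (e₁ b) ⟩
  Θ (V₁ a) ++ Θ (V₁ b)          ≡⟨ sym (Θ-++ (V₁ a) (V₁ b)) ⟩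
  Θ (V₁ a ++ V₁ b)              ≡⟨ cong Θ eq ⟩
  Θ (V₂ a ++ V₂ b)              ≡⟨ Θ-++ (V₂ a) (V₂ b) ⟩
  Θ (V₂ a) ++ Θ (V₂ b)          ≡⟨ sym (cong₂ _++_ (e₂ a) (e₂ b)) ⟩
  φ₂ a ++ φ₂ b                  ≡⟨ cong (φ₂ a ++_) (sym (++-identityʳ (φ₂ b))) ⟩
  φ₂ a ++ (φ₂ b ++ [])          ∎

module _ (w : Word) (k h : ℕ) where

  P : Word
  P = R w ++ w

  Vψ Vξ : Morphism
  Vψ false = w ++ (P ^ʷ k)
  Vψ true  = (P ^ʷ h) ++ R w
  Vξ false = w
  Vξ true  = (P ^ʷ (k + h)) ++ R w

  ψ-Θ : ∀ c → ψ w k h c ≡ Θ (Vψ c)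
  ψ-Θ false = refl
  ψ-Θ true  = refl

  ξ-Θ : ∀ c → ξ w k h c ≡ Θ (Vξ c)
  ξ-Θ false = refl
  ξ-Θ true  = refl

  Vψ01≡Vξ01 : Vψ false ++ Vψ true ≡ Vξ false ++ Vξ true
  Vψ01≡Vξ01 = begin
    (w ++ (P ^ʷ k)) ++ ((P ^ʷ h) ++ R w)  ≡⟨ ++-assoc w _ _ ⟩
    w ++ ((P ^ʷ k) ++ ((P ^ʷ h) ++ R w))  ≡⟨ cong (w ++_) (sym (++-assoc (P ^ʷ k) _ _)) ⟩
    w ++ (((P ^ʷ k) ++ (P ^ʷ h)) ++ R w)  ≡⟨ cong (λ q → w ++ (q ++ R w)) (sym (pow-+ P k h)) ⟩
    w ++ ((P ^ʷ (k + h)) ++ R w)          ∎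

  Vψ10≡Vξ10 : Vψ true ++ Vψ false ≡ Vξ true ++ Vξ false
  Vψ10≡Vξ10 = begin
    ((P ^ʷ h) ++ R w) ++ (w ++ (P ^ʷ k))  ≡⟨ ++-assoc (P ^ʷ h) (R w) _ ⟩
    (P ^ʷ h) ++ (R w ++ (w ++ (P ^ʷ k)))  ≡⟨ cong ((P ^ʷ h) ++_) (sym (++-assoc (R w) w (P ^ʷ k))) ⟩
    (P ^ʷ h) ++ (P ++ (P ^ʷ k))           ≡⟨ cong ((P ^ʷ h) ++_) (pow-comm P k) ⟩
    (P ^ʷ h) ++ ((P ^ʷ k) ++ P)           ≡⟨ sym (++-assoc (P ^ʷ h) (P ^ʷ k) P) ⟩
    ((P ^ʷ h) ++ (P ^ʷ k)) ++ P           ≡⟨ cong (_++ P) (sym (pow-+ P h k)) ⟩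
    (P ^ʷ (h + k)) ++ P                   ≡⟨ cong (λ m → (P ^ʷ m) ++ P) (+-comm h k) ⟩
    (P ^ʷ (k + h)) ++ (R w ++ w)          ≡⟨ sym (++-assoc (P ^ʷ (k + h)) (R w) w) ⟩
    ((P ^ʷ (k + h)) ++ R w) ++ w          ∎

  ψ∘Θ≡ξ∘Θ : ∀ x → morph* (ψ w k h) (Θ x) ≡ morph* (ξ w k h) (Θ x)
  ψ∘Θ≡ξ∘Θ = agree-on-images (ψ w k h) (ξ w k h) Θ₀ on-blocks
    where
    on-blocks : ∀ c → morph* (ψ w k h) (Θ₀ c) ≡ morph* (ξ w k h) (Θ₀ c)
    on-blocks false = Θ∘-pair-cong (ψ w k h) Vψ (ξ w k h) Vξ ψ-Θ ξ-Θ false true Vψ01≡Vξ01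
    on-blocks true  = Θ∘-pair-cong (ψ w k h) Vψ (ξ w k h) Vξ ψ-Θ ξ-Θ true false Vψ10≡Vξ10

  module _ (w≢[] : w ≢ []) where

    Vψ-nonErasing : NonErasing Vψ
    Vψ-nonErasing false = nonempty-++ˡ w (P ^ʷ k) (nonempty w w≢[])
    Vψ-nonErasing true  = nonempty-++ʳ (P ^ʷ h) (R w) (nonempty-reverse w w≢[])

    Vξ-nonErasing : NonErasing Vξ
    Vξ-nonErasing false = nonempty w w≢[]
    Vξ-nonErasing true  = nonempty-++ʳ (P ^ʷ (k + h)) (R w) (nonempty-reverse w w≢[])

proposition21 : (w : Word) → w ≢ [] → (k h : ℕ) → 1 ≤ k + h →
    (u : InfWord) → IsFixedPoint (ψ w k h) u ⇔ IsFixedPoint (ξ w k h) u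
proposition21 w w≢[] k h _ u = mk⇔
  (fixedPoint-transfer (ψ w k h) (Vψ w k h) (ξ w k h) (Vξ w k h) (ψ-Θ w k h) (ξ-Θ w k h)
     neψ neξ (ψ∘Θ≡ξ∘Θ w k h) u)
  (fixedPoint-transfer (ξ w k h) (Vξ w k h) (ψ w k h) (Vψ w k h) (ξ-Θ w k h) (ψ-Θ w k h)
     neξ neψ (λ x → sym (ψ∘Θ≡ξ∘Θ w k h x)) u)
  where
  neψ : NonErasing (Vψ w k h)
  neψ = Vψ-nonErasing w k h w≢[]
  neξ : NonErasing (Vξ w k h)
  neξ = Vξ-nonErasing w k h w≢[]
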